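{- Let $1\le k<n$, $w=(y_1,\dots,y_{k-r},\overline{z_r},\dots,\overline{z_1},v_1,\dots,v_{n-k})\in W^{OG(k,2n+1)}$ and $\lambda=\lambda(w)$. Then for $1\le i\le k$, \[\lambda^{(1)}_i=\begin{cases}n+1-k+|\{l:z_i<v_l\}| & i\le r\\ |\{l:y_{k+1-i}>v_l\}| & i>r\end{cases},\qquad \lambda^{(2)}_i=\begin{cases}|\{q:z_i<z_q\}|+|\{t:z_i<y_t\}| & i\le r\\ 0 & i>r.\end{cases}\]
   Context: $W^{OG(k,2n+1)}$: signed permutations in one-line notation $(y_1,\dots,y_{k-r},\overline{z_r},\dots,\overline{z_1},v_1,\dots,v_{n-k})$, $0\le r\le k$, $\{y\}\cup\{z\}\cup\{v\}=\{1,\dots,n\}$, $y_1<\dots<y_{k-r}$, $z_r>\dots>z_1$, $v_1<\dots<v_{n-k}$, bars denoting negative entries (so position $k+1-i$ holds $\overline{z_i}$ when $i\le r$ and $y_{k+1-i}$ when $i>r$). $w$ acts on $\mathbb{R}^n$ by $w(e_a)=e_m$ if the $a$-th entry is $m$ and $-e_m$ if it is $\overline m$. Type $B_n$ positive roots are $e_a\pm e_b$ ($a<b$) and $e_a$; $\lambda(w)=\{\alpha>0:w(\alpha)<0\}$. For $S$ a set of positive roots, $S^{(1)}_i=|S\cap(\{e_{k+1-i}\pm e_c:c>k\}\cup\{e_{k+1-i}\})|$ and $S^{(2)}_i=|\{a<k+1-i:e_a+e_{k+1-i}\in S\}|$. -}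

module Defs where

open import Data.Nat using (ℕ; zero; suc; _+_; _∸_; _≤_; _<_; _≤ᵇ_; _≡ᵇ_; _<?_)
open import Data.Integer as ℤ using (ℤ; +_; -_)
open import Data.Bool using (Bool; true; false; if_then_else_)
open import Data.List using (List; []; _∷_; length; filter; map; foldr; upTo)
open import Data.List.Membership.Propositional using (_∈_)
open import Data.List.Relation.Unary.Unique.Propositional using (Unique)
open import Data.List.Relation.Unary.Linked using (Linked)
open import Data.List.Relation.Binary.Permutation.Propositional using (_↭_)
open import Data.Product using (Σ; ∃; _×_; _,_)
open import Data.Sum using (_⊎_)
open import Function.Bundles using (_⇔_)
open import Relation.Binary.PropositionalEquality using (_≡_)
open import Data.List using (_++_)

HasCard : {A : Set} → (A → Set) → ℕ → Set
HasCard {A} P m = Σ (List A) λ xs → Unique xs × length xs ≡ m × (∀ x → (x ∈ xs) ⇔ P x)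

-- 1-indexed lookup in a list (junk value 0 out of range)
nth : List ℕ → ℕ → ℕ
nth [] _ = 0
nth (x ∷ xs) zero = 0
nth (x ∷ xs) (suc zero) = x
nth (x ∷ xs) (suc (suc j)) = nth xs (suc j)

countGt : ℕ → List ℕ → ℕ
countGt a xs = length (filter (λ x → a <? x) xs)

countLt : ℕ → List ℕ → ℕ
countLt a xs = length (filter (λ x → x <? a) xs)

range1 : ℕ → List ℕ
range1 n = map suc (upTo n)

record WOG (n k : ℕ) : Set where
  field
    r : ℕ
    y z v : List ℕ       -- y = [y_1..y_{k-r}], z = [z_1..z_r], v = [v_1..v_{n-k}]
    r≤k : r ≤ k
    len-y : length y ≡ k ∸ r
    len-z : length z ≡ r
    len-v : length v ≡ n ∸ k
    y-inc : Linked _<_ y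
    z-inc : Linked _<_ z
    v-inc : Linked _<_ v
    perm  : (y ++ z ++ v) ↭ range1 n

module _ {n k : ℕ} (w : WOG n k) where
  open WOG w

  -- absolute value and sign of the entry at position p of the one-line
  -- notation (y_1,..,y_{k-r}, z̄_r,..,z̄_1, v_1,..,v_{n-k})
  entryVal : ℕ → ℕ
  entryVal p = if p ≤ᵇ (k ∸ r) then nth y p
               else if p ≤ᵇ k then nth z (suc k ∸ p)
               else nth v (p ∸ k)

  entrySgn : ℕ → ℤ
  entrySgn p = if p ≤ᵇ (k ∸ r) then + 1
               else if p ≤ᵇ k then - (+ 1)
               else + 1

  -- w(e_p), as a coordinate function (coordinates 1..n)
  wBasis : ℕ → ℕ → ℤ
  wBasis p c = if entryVal p ≡ᵇ c then entrySgn p else + 0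

sumOver : List ℕ → (ℕ → ℤ) → ℤ
sumOver xs f = foldr (λ a s → f a ℤ.+ s) (+ 0) xs

act : {n k : ℕ} → WOG n k → (ℕ → ℤ) → (ℕ → ℤ)
act {n} w x c = sumOver (range1 n) (λ a → x a ℤ.* wBasis w a c)

data Root : Set where
  e-_ : ℕ × ℕ → Root
  e+_ : ℕ × ℕ → Root
  e   : ℕ → Root

unit : ℕ → ℕ → ℤ
unit a c = if a ≡ᵇ c then + 1 else + 0

vec : Root → ℕ → ℤ
vec (e- (a , b)) c = unit a c ℤ.- unit b c
vec (e+ (a , b)) c = unit a c ℤ.+ unit b c
vec (e a) c = unit a c

data IsPos (n : ℕ) : Root → Set where
  pos-  : ∀ {a b} → 1 ≤ a → a < b → b ≤ n → IsPos n (e- (a , b))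
  pos+  : ∀ {a b} → 1 ≤ a → a < b → b ≤ n → IsPos n (e+ (a , b))
  pos1  : ∀ {a} → 1 ≤ a → a ≤ n → IsPos n (e a)

IsNegRoot : ℕ → (ℕ → ℤ) → Set
IsNegRoot n x = Σ Root λ β → IsPos n β × (∀ c → 1 ≤ c → c ≤ n → x c ≡ - vec β c)

inv : {n k : ℕ} → WOG n k → Root → Set
inv {n} w α = IsPos n α × IsNegRoot n (act w (vec α))

Block1 : ℕ → ℕ → Root → Set
Block1 k i α =
  (Σ ℕ λ c → k < c × (α ≡ e- (suc k ∸ i , c) ⊎ α ≡ e+ (suc k ∸ i , c)))
  ⊎ α ≡ e (suc k ∸ i)

Card1 : (Root → Set) → ℕ → ℕ → ℕ → Set
Card1 S k i m = HasCard (λ α → S α × Block1 k i α) m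

Card2 : (Root → Set) → ℕ → ℕ → ℕ → Set
Card2 S k i m = HasCard (λ a → a < suc k ∸ i × S (e+ (a , suc k ∸ i))) m

lam1 : {n k : ℕ} → WOG n k → ℕ → ℕ
lam1 {n} {k} w i = if i ≤ᵇ WOG.r w
  then (suc n ∸ k) + countGt (nth (WOG.z w) i) (WOG.v w)
  else countLt (nth (WOG.y w) (suc k ∸ i)) (WOG.v w)

lam2 : {n k : ℕ} → WOG n k → ℕ → ℕ
lam2 {n} {k} w i = if i ≤ᵇ WOG.r w
  then countGt (nth (WOG.z w) i) (WOG.z w) + countGt (nth (WOG.z w) i) (WOG.y w)
  else 0

module Submission where

-- Fix i and p = k+1-i.  The entry at position p gives w(e_p) = -e_{z_i} if
-- i ≤ r and w(e_p) = +e_{y_p} if i > r, while w(e_c) = +e_{v_{c-k}} for c > k.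
-- By linearity every root of block i is sent to a signed sum of at most two
-- distinct unit vectors, and such a vector is recognised as a negative root by
-- three criteria: -e_u and -e_u - e_u' are negative roots, vectors without
-- negative coordinates are not, and e_u - e_u' is one iff u' < u.  This
-- describes each block as a disjoint union of injective images of sets of
-- positions, whose sizes follow from a small algebra of finite cardinalities.

open import Data.Nat using (ℕ; zero; suc; _+_; _∸_; _≤_; _<_; _≤ᵇ_; _≡ᵇ_; _<?_; _≤?_; z≤n; s≤s)
open import Data.Nat.Properties
open import Data.Integer as ℤ using (ℤ; +_; -_; +≤+)
import Data.Integer.Properties as ℤP
open import Data.Bool using (true; false; if_then_else_; T)
open import Data.Unit using (tt)
open import Data.Empty using (⊥-elim)
open import Data.Product using (Σ; _×_; _,_; proj₁; proj₂)
open import Data.Sum using (_⊎_; inj₁; inj₂)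
import Data.Sum as Sum
import Data.Product as Product
open import Data.List using (List; []; _∷_; length; filter; map; applyUpTo; _++_)
open import Data.List.Properties using (length-++; length-map; length-applyUpTo; map-applyUpTo; filter-all; filter-reject)
open import Data.List.Membership.Propositional using (_∈_)
open import Data.List.Membership.Propositional.Properties
open import Data.List.Relation.Unary.Any using (here; there)
import Data.List.Relation.Unary.All as All
open import Data.List.Relation.Unary.AllPairs using (AllPairs; []; _∷_)
open import Data.List.Relation.Unary.Unique.Propositional using (Unique)
import Data.List.Relation.Unary.Unique.Propositional.Properties as Unique
open import Data.List.Relation.Unary.Linked.Properties using (Linked⇒AllPairs)
open import Data.List.Relation.Binary.Permutation.Propositional using (↭-sym; ↭⇒↭ₛ)
open import Data.List.Relation.Binary.Permutation.Propositional.Properties using (∈-resp-↭)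
import Data.List.Relation.Binary.Permutation.Setoid.Properties as PermutationSetoid
open import Relation.Nullary using (¬_; yes; no)
open import Relation.Unary using (Decidable)
open import Relation.Binary.Definitions using (tri<; tri≈; tri>)
open import Relation.Binary.PropositionalEquality
open import Function using (_∘_)
open import Function.Bundles using (_⇔_; mk⇔; Equivalence)
import Function.Properties.Equivalence as ⇔
open import Algebra.Properties.CommutativeSemigroup ℤP.+-commutativeSemigroup using (interchange)
open import Defs

open Equivalence using (to; from)

-- Finite cardinalities  (HasCard P m : "P has exactly m elements")

module _ {A : Set} where

  card-resp : ∀ {P Q : A → Set} {m} → (∀ x → P x ⇔ Q x) → HasCard P m → HasCard Q m
  card-resp P⇔Q (xs , uniq , len , mem) = xs , uniq , len , λ x → ⇔.trans (mem x) (P⇔Q x)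

  card-empty : ∀ {P : A → Set} → (∀ x → ¬ P x) → HasCard P 0
  card-empty ¬P = [] , [] , refl , λ x → mk⇔ (λ ()) (⊥-elim ∘ ¬P x)

  card-single : (a : A) → HasCard (λ x → x ≡ a) 1
  card-single a = a ∷ [] , All.[] ∷ [] , refl , λ x → mk⇔ (λ { (here eq) → eq ; (there ()) }) here

  card-⊎ : ∀ {P Q : A → Set} {m m'} → (∀ x → P x → ¬ Q x) →
           HasCard P m → HasCard Q m' → HasCard (λ x → P x ⊎ Q x) (m + m')
  card-⊎ disjoint (xs , u , len , mem) (xs' , u' , len' , mem') =
    xs ++ xs' ,
    Unique.++⁺ u u' (λ (p , q) → disjoint _ (to (mem _) p) (to (mem' _) q)) ,
    trans (length-++ xs) (cong₂ _+_ len len') ,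
    λ x → mk⇔ (Sum.map (to (mem x)) (to (mem' x)) ∘ ∈-++⁻ xs)
              (Sum.[ ∈-++⁺ˡ ∘ from (mem x) , ∈-++⁺ʳ xs ∘ from (mem' x) ])

  card-image : ∀ {B : Set} {P : A → Set} {m} (f : A → B) → (∀ {a a'} → f a ≡ f a' → a ≡ a') →
               HasCard P m → HasCard (λ b → Σ A λ a → P a × b ≡ f a) m
  card-image f injective (xs , u , len , mem) =
    map f xs , Unique.map⁺ injective u , trans (length-map f xs) len ,
    λ b → mk⇔ (λ b∈ → let (a , a∈ , eq) = ∈-map⁻ f b∈ in a , to (mem a) a∈ , eq)
              (λ { (a , Pa , refl) → ∈-map⁺ f (from (mem a) Pa) })

  card-filter : ∀ {Q : A → Set} (Q? : Decidable Q) xs → Unique xs →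
                HasCard (λ x → x ∈ xs × Q x) (length (filter Q? xs))
  card-filter Q? xs u =
    filter Q? xs , Unique.filter⁺ Q? u , refl ,
    λ x → mk⇔ (∈-filter⁻ Q?) (λ (x∈ , Qx) → ∈-filter⁺ Q? x∈ Qx)

interval : ℕ → ℕ → List ℕ
interval s m = applyUpTo (λ j → suc (s + j)) m

∈-interval : ∀ {s m c} → c ∈ interval s m ⇔ (s < c × c ≤ s + m)
∈-interval {s} {m} {c} = mk⇔ bounds member
  where
  bounds : c ∈ interval s m → s < c × c ≤ s + m
  bounds c∈ with ∈-applyUpTo⁻ (λ j → suc (s + j)) c∈
  ... | j , j<m , refl = s≤s (m≤m+n s j) , subst (_≤ s + m) (+-suc s j) (+-monoʳ-≤ s j<m)

  member : s < c × c ≤ s + m → c ∈ interval s m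
  member (s<c , c≤) with m≤n⇒∃[o]m+o≡n s<c
  ... | j , refl = ∈-applyUpTo⁺ (λ j → suc (s + j)) (+-cancelˡ-≤ s (suc j) m (subst (_≤ s + m) (sym (+-suc s j)) c≤))

unique-interval : ∀ s m → Unique (interval s m)
unique-interval s m = Unique.applyUpTo⁺₁ _ m (λ i<j _ eq → <⇒≢ i<j (+-cancelˡ-≡ s _ _ (suc-injective eq)))

card-interval : ∀ s m → HasCard (λ c → s < c × c ≤ s + m) m
card-interval s m = interval s m , unique-interval s m , length-applyUpTo _ m , λ c → ∈-interval

length-filter-map : ∀ {Q : ℕ → Set} (Q? : Decidable Q) (f : ℕ → ℕ) xs →
                    length (filter (Q? ∘ f) xs) ≡ length (filter Q? (map f xs))
length-filter-map Q? f [] = refl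
length-filter-map Q? f (x ∷ xs) with Q? (f x)
... | yes _ = cong suc (length-filter-map Q? f xs)
... | no _ = length-filter-map Q? f xs

applyUpTo-nth : ∀ xs (g : ℕ → ℕ) → (∀ j → j < length xs → g j ≡ nth xs (suc j)) → applyUpTo g (length xs) ≡ xs
applyUpTo-nth [] g agree = refl
applyUpTo-nth (x ∷ xs) g agree =
  cong₂ _∷_ (agree 0 (s≤s z≤n)) (applyUpTo-nth xs (g ∘ suc) (λ j j< → agree (suc j) (s≤s j<)))

card-positions : ∀ {Q : ℕ → Set} (Q? : Decidable Q) (f : ℕ → ℕ) s xs →
                 (∀ j → j < length xs → f (suc (s + j)) ≡ nth xs (suc j)) →
                 HasCard (λ c → (s < c × c ≤ s + length xs) × Q (f c)) (length (filter Q? xs))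
card-positions Q? f s xs reads =
  subst (HasCard _) count
    (card-resp (λ c → mk⇔ (Product.map₁ (to ∈-interval)) (Product.map₁ (from ∈-interval)))
      (card-filter (Q? ∘ f) (interval s (length xs)) (unique-interval s (length xs))))
  where
  count : length (filter (Q? ∘ f) (interval s (length xs))) ≡ length (filter Q? xs)
  count = trans (length-filter-map Q? f (interval s (length xs)))
                (cong (length ∘ filter Q?) (trans (map-applyUpTo _ f _) (applyUpTo-nth xs _ reads)))

nth-∈ : ∀ xs {j} → 1 ≤ j → j ≤ length xs → nth xs j ∈ xs
nth-∈ (x ∷ xs) {suc zero} _ _ = here refl
nth-∈ (x ∷ xs) {suc (suc j)} _ (s≤s j≤) = there (nth-∈ xs (s≤s z≤n) j≤)

nth-increasing : ∀ {xs} → AllPairs _<_ xs → ∀ {i j} → 1 ≤ i → i < j → j ≤ length xs → nth xs i < nth xs j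
nth-increasing {x ∷ xs} (x< ∷ _) {suc zero} {suc (suc j)} _ _ (s≤s j≤) = All.lookup x< (nth-∈ xs (s≤s z≤n) j≤)
nth-increasing {[]} _ _ (s≤s _) ()
nth-increasing {x ∷ xs} _ {suc zero} {suc zero} _ (s≤s ()) _
nth-increasing {x ∷ xs} (_ ∷ inc) {suc (suc i)} {suc (suc j)} _ (s≤s i<j) (s≤s j≤) =
  nth-increasing inc (s≤s z≤n) i<j j≤

countGt-increasing : ∀ {xs} → AllPairs _<_ xs → ∀ {i} → 1 ≤ i → i ≤ length xs → countGt (nth xs i) xs ≡ length xs ∸ i
countGt-increasing {x ∷ xs} (x< ∷ _) {suc zero} _ _ =
  cong length (trans (filter-reject (x <?_) (<-irrefl refl)) (filter-all (x <?_) x<))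
countGt-increasing {x ∷ xs} (x< ∷ inc) {suc (suc i)} _ (s≤s i≤) =
  trans (cong length (filter-reject (nth xs (suc i) <?_) (<-asym (All.lookup x< (nth-∈ xs (s≤s z≤n) i≤)))))
        (countGt-increasing inc (s≤s z≤n) i≤)

unique-++-distinct : ∀ {A : Set} {xs ys : List A} {a b} → Unique (xs ++ ys) → a ∈ xs → b ∈ ys → a ≢ b
unique-++-distinct {xs = x ∷ xs} (x∉ ∷ _) (here refl) b∈ = All.lookup x∉ (∈-++⁺ʳ xs b∈)
unique-++-distinct {xs = x ∷ xs} (_ ∷ u) (there a∈) b∈ = unique-++-distinct u a∈ b∈

unique-++ʳ : ∀ {A : Set} {xs ys : List A} → Unique (xs ++ ys) → Unique ys
unique-++ʳ {xs = []} u = u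
unique-++ʳ {xs = x ∷ xs} (_ ∷ u) = unique-++ʳ {xs = xs} u

unit-self : ∀ a → unit a a ≡ + 1
unit-self a with a ≡ᵇ a | ≡⇒≡ᵇ a a refl
... | true | _ = refl

unit-other : ∀ {a c} → a ≢ c → unit a c ≡ + 0
unit-other {a} {c} a≢c with a ≡ᵇ c in eq
... | true = ⊥-elim (a≢c (≡ᵇ⇒≡ a c (subst T (sym eq) tt)))
... | false = refl

unit-below : ∀ {a c} → c < a → unit a c ≡ + 0
unit-below c<a = unit-other (λ a≡c → <-irrefl (sym a≡c) c<a)

unit-nonneg : ∀ a c → + 0 ℤ.≤ unit a c
unit-nonneg a c with a ≡ᵇ c
... | true = +≤+ z≤n
... | false = +≤+ z≤n

sumOver-cong : ∀ xs {f g : ℕ → ℤ} → f ≗ g → sumOver xs f ≡ sumOver xs g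
sumOver-cong [] f≗g = refl
sumOver-cong (x ∷ xs) f≗g = cong₂ ℤ._+_ (f≗g x) (sumOver-cong xs f≗g)

sumOver-+ : ∀ xs (f g : ℕ → ℤ) → sumOver xs (λ a → f a ℤ.+ g a) ≡ sumOver xs f ℤ.+ sumOver xs g
sumOver-+ [] f g = refl
sumOver-+ (x ∷ xs) f g =
  trans (cong (λ s → f x ℤ.+ g x ℤ.+ s) (sumOver-+ xs f g)) (interchange (f x) (g x) _ _)

sumOver-neg : ∀ xs (f : ℕ → ℤ) → sumOver xs (λ a → - f a) ≡ - sumOver xs f
sumOver-neg [] f = refl
sumOver-neg (x ∷ xs) f = trans (cong (λ s → - f x ℤ.+ s) (sumOver-neg xs f)) (sym (ℤP.neg-distrib-+ (f x) _))

sumOver-absent : ∀ xs b (g : ℕ → ℤ) → ¬ b ∈ xs → sumOver xs (λ a → unit b a ℤ.* g a) ≡ + 0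
sumOver-absent [] b g b∉ = refl
sumOver-absent (x ∷ xs) b g b∉ =
  cong₂ ℤ._+_ (cong (ℤ._* g x) (unit-other (b∉ ∘ here))) (sumOver-absent xs b g (b∉ ∘ there))

sumOver-sift : ∀ xs b (g : ℕ → ℤ) → Unique xs → b ∈ xs → sumOver xs (λ a → unit b a ℤ.* g a) ≡ g b
sumOver-sift (x ∷ xs) b g (x∉ ∷ _) (here refl) =
  trans (cong₂ ℤ._+_ (trans (cong (ℤ._* g b) (unit-self b)) (ℤP.*-identityˡ (g b)))
                     (sumOver-absent xs b g (λ b∈ → All.lookup x∉ b∈ refl)))
        (ℤP.+-identityʳ (g b))
sumOver-sift (x ∷ xs) b g (x∉ ∷ u) (there b∈) =
  trans (cong₂ ℤ._+_ (cong (ℤ._* g x) (unit-other (λ eq → All.lookup x∉ b∈ (sym eq)))) (sumOver-sift xs b g u b∈))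
        (ℤP.+-identityˡ (g b))

unique-range1 : ∀ n → Unique (range1 n)
unique-range1 n = Unique.map⁺ suc-injective (Unique.upTo⁺ n)

∈-range1 : ∀ {n a} → a ∈ range1 n ⇔ (1 ≤ a × a ≤ n)
∈-range1 = mk⇔ bounds member
  where
  bounds : ∀ {n a} → a ∈ range1 n → 1 ≤ a × a ≤ n
  bounds a∈ with ∈-map⁻ suc a∈
  ... | m , m∈ , refl = s≤s z≤n , ∈-upTo⁻ m∈

  member : ∀ {n a} → 1 ≤ a × a ≤ n → a ∈ range1 n
  member {a = suc m} (_ , s≤s m<n) = ∈-map⁺ suc (∈-upTo⁺ (s≤s m<n))

module Action {n k : ℕ} (w : WOG n k) where

  act-+ : ∀ x x' → act w (λ c → x c ℤ.+ x' c) ≗ λ c → act w x c ℤ.+ act w x' c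
  act-+ x x' c =
    trans (sumOver-cong (range1 n) (λ a → ℤP.*-distribʳ-+ (wBasis w a c) (x a) (x' a)))
          (sumOver-+ (range1 n) (λ a → x a ℤ.* wBasis w a c) (λ a → x' a ℤ.* wBasis w a c))

  act-neg : ∀ x → act w (λ c → - x c) ≗ λ c → - act w x c
  act-neg x c =
    trans (sumOver-cong (range1 n) (λ a → sym (ℤP.neg-distribˡ-* (x a) (wBasis w a c))))
          (sumOver-neg (range1 n) (λ a → x a ℤ.* wBasis w a c))

  image-e : ∀ {a} → 1 ≤ a → a ≤ n → act w (vec (e a)) ≗ wBasis w a
  image-e {a} 1≤a a≤n c =
    sumOver-sift (range1 n) a (λ a' → wBasis w a' c) (unique-range1 n) (from ∈-range1 (1≤a , a≤n))

  image-e+ : ∀ {a b} → 1 ≤ a → a ≤ n → 1 ≤ b → b ≤ n →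
             act w (vec (e+ (a , b))) ≗ λ c → wBasis w a c ℤ.+ wBasis w b c
  image-e+ {a} {b} 1≤a a≤n 1≤b b≤n c =
    trans (act-+ (unit a) (unit b) c) (cong₂ ℤ._+_ (image-e 1≤a a≤n c) (image-e 1≤b b≤n c))

  image-e- : ∀ {a b} → 1 ≤ a → a ≤ n → 1 ≤ b → b ≤ n →
             act w (vec (e- (a , b))) ≗ λ c → wBasis w a c ℤ.+ - wBasis w b c
  image-e- {a} {b} 1≤a a≤n 1≤b b≤n c =
    trans (act-+ (unit a) (λ c → - unit b c) c)
          (cong₂ ℤ._+_ (image-e 1≤a a≤n c) (trans (act-neg (unit b) c) (cong -_ (image-e 1≤b b≤n c))))

-- Negative roots

positive-leading : ∀ {n β} → IsPos n β →
                   Σ ℕ λ a → (1 ≤ a × a ≤ n) × vec β a ≡ + 1 × (∀ {c} → c < a → vec β c ≡ + 0)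
positive-leading (pos- {a} 1≤a a<b b≤n) =
  a , (1≤a , <⇒≤ (<-≤-trans a<b b≤n)) ,
  cong₂ ℤ._-_ (unit-self a) (unit-below a<b) ,
  λ c<a → cong₂ ℤ._-_ (unit-below c<a) (unit-below (<-trans c<a a<b))
positive-leading (pos+ {a} 1≤a a<b b≤n) =
  a , (1≤a , <⇒≤ (<-≤-trans a<b b≤n)) ,
  cong₂ ℤ._+_ (unit-self a) (unit-below a<b) ,
  λ c<a → cong₂ ℤ._+_ (unit-below c<a) (unit-below (<-trans c<a a<b))
positive-leading (pos1 {a} 1≤a a≤n) = a , (1≤a , a≤n) , unit-self a , unit-below

negRoot-≗ : ∀ {n x x'} → x ≗ x' → IsNegRoot n x ⇔ IsNegRoot n x'
negRoot-≗ x≗x' =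
  mk⇔ (λ (β , β>0 , x≡-β) → β , β>0 , λ c 1≤c c≤n → trans (sym (x≗x' c)) (x≡-β c 1≤c c≤n))
      (λ (β , β>0 , x≡-β) → β , β>0 , λ c 1≤c c≤n → trans (x≗x' c) (x≡-β c 1≤c c≤n))

negRoot-leading : ∀ {n x m} → IsNegRoot n x → 1 ≤ m → m ≤ n → x m ≢ + 0 →
                  (∀ {c} → 1 ≤ c → c < m → x c ≡ + 0) → x m ≡ - + 1
negRoot-leading {x = x} {m} (β , β>0 , x≡-β) 1≤m m≤n x[m]≢0 zero-below with positive-leading β>0
... | a , (1≤a , a≤n) , β[a]≡1 , β-below with <-cmp a m
... | tri< a<m _ _ = ⊥-elim (0≢-1 (trans (sym (zero-below 1≤a a<m)) (trans (x≡-β a 1≤a a≤n) (cong -_ β[a]≡1))))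
  where
  0≢-1 : + 0 ≢ - + 1
  0≢-1 ()
... | tri≈ _ refl _ = trans (x≡-β a 1≤a a≤n) (cong -_ β[a]≡1)
... | tri> _ _ m<a = ⊥-elim (x[m]≢0 (trans (x≡-β m 1≤m m≤n) (cong -_ (β-below m<a))))

nonneg-not-negRoot : ∀ {n x} → (∀ c → + 0 ℤ.≤ x c) → ¬ IsNegRoot n x
nonneg-not-negRoot x≥0 (β , β>0 , x≡-β) with positive-leading β>0
... | a , (1≤a , a≤n) , β[a]≡1 , _ =
  0≰-1 (subst (+ 0 ℤ.≤_) (trans (x≡-β a 1≤a a≤n) (cong -_ β[a]≡1)) (x≥0 a))
  where
  0≰-1 : ¬ (+ 0 ℤ.≤ - + 1)
  0≰-1 ()

unit-not-negRoot : ∀ {n} u → ¬ IsNegRoot n (unit u)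
unit-not-negRoot u = nonneg-not-negRoot (unit-nonneg u)

sum-not-negRoot : ∀ {n} u u' → ¬ IsNegRoot n (λ c → unit u c ℤ.+ unit u' c)
sum-not-negRoot u u' = nonneg-not-negRoot (λ c → ℤP.+-mono-≤ (unit-nonneg u c) (unit-nonneg u' c))

neg-unit-negRoot : ∀ {n u} → 1 ≤ u → u ≤ n → IsNegRoot n (λ c → - unit u c)
neg-unit-negRoot 1≤u u≤n = e _ , pos1 1≤u u≤n , λ _ _ _ → refl

neg-sum-negRoot : ∀ {n u u'} → 1 ≤ u → u ≤ n → 1 ≤ u' → u' ≤ n → u ≢ u' →
                  IsNegRoot n (λ c → - unit u c ℤ.+ - unit u' c)
neg-sum-negRoot {u = u} {u'} 1≤u u≤n 1≤u' u'≤n u≢u' with <-cmp u u'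
... | tri< u<u' _ _ = e+ (u , u') , pos+ 1≤u u<u' u'≤n , λ c _ _ → sym (ℤP.neg-distrib-+ (unit u c) (unit u' c))
... | tri≈ _ u≡u' _ = ⊥-elim (u≢u' u≡u')
... | tri> _ _ u'<u = e+ (u' , u) , pos+ 1≤u' u'<u u≤n ,
  λ c _ _ → trans (ℤP.+-comm (- unit u c) (- unit u' c)) (sym (ℤP.neg-distrib-+ (unit u' c) (unit u c)))

neg-difference : ∀ a b → - (a ℤ.+ - b) ≡ b ℤ.+ - a
neg-difference a b =
  trans (ℤP.neg-distrib-+ a (- b)) (trans (cong (λ t → - a ℤ.+ t) (ℤP.neg-involutive b)) (ℤP.+-comm (- a) b))

difference-negRoot : ∀ {n u u'} → 1 ≤ u → u ≤ n → 1 ≤ u' → u' ≤ n → u ≢ u' →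
                     IsNegRoot n (λ c → unit u c ℤ.+ - unit u' c) ⇔ u' < u
difference-negRoot {n} {u} {u'} 1≤u u≤n 1≤u' u'≤n u≢u' = mk⇔ order negative
  where
  order : IsNegRoot n (λ c → unit u c ℤ.+ - unit u' c) → u' < u
  order neg with <-cmp u u'
  ... | tri< u<u' _ _ =
    ⊥-elim (1≢-1 (trans (sym leading) (negRoot-leading neg 1≤u u≤n (λ eq → 1≢0 (trans (sym leading) eq)) zero-below)))
    where
    leading : unit u u ℤ.+ - unit u' u ≡ + 1
    leading = cong₂ (λ s t → s ℤ.+ - t) (unit-self u) (unit-below u<u')
    zero-below : ∀ {c} → 1 ≤ c → c < u → unit u c ℤ.+ - unit u' c ≡ + 0
    zero-below {c} _ c<u = cong₂ (λ s t → s ℤ.+ - t) (unit-below c<u) (unit-below (<-trans c<u u<u'))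
    1≢-1 : + 1 ≢ - + 1
    1≢-1 ()
    1≢0 : + 1 ≢ + 0
    1≢0 ()
  ... | tri≈ _ u≡u' _ = ⊥-elim (u≢u' u≡u')
  ... | tri> _ _ u'<u = u'<u

  negative : u' < u → IsNegRoot n (λ c → unit u c ℤ.+ - unit u' c)
  negative u'<u = e- (u' , u) , pos- 1≤u' u'<u u≤n , λ c _ _ → sym (neg-difference (unit u' c) (unit u c))

if-≤ᵇ-yes : ∀ {A : Set} {m n} {x x' : A} → m ≤ n → (if m ≤ᵇ n then x else x') ≡ x
if-≤ᵇ-yes {m = m} {n} m≤n with m ≤ᵇ n | ≤⇒≤ᵇ m≤n
... | true | _ = refl

if-≤ᵇ-no : ∀ {A : Set} {m n} {x x' : A} → n < m → (if m ≤ᵇ n then x else x') ≡ x'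
if-≤ᵇ-no {m = m} {n} n<m with m ≤ᵇ n | ≤ᵇ⇒≤ m n
... | true | m≤n = ⊥-elim (<⇒≱ n<m (m≤n tt))
... | false | _ = refl

wBasis-plus : ∀ {n k} (w : WOG n k) p → entrySgn w p ≡ + 1 → wBasis w p ≗ unit (entryVal w p)
wBasis-plus w p sign c with entryVal w p ≡ᵇ c
... | true = sign
... | false = refl

wBasis-minus : ∀ {n k} (w : WOG n k) p → entrySgn w p ≡ - + 1 → wBasis w p ≗ λ c → - unit (entryVal w p) c
wBasis-minus w p sign c with entryVal w p ≡ᵇ c
... | true = sign
... | false = refl

suc-+-∸ : ∀ k j → suc (k + j) ∸ k ≡ suc j
suc-+-∸ k j = trans (cong (_∸ k) (sym (+-suc k j))) (m+n∸m≡n k (suc j))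

module Entries {n k : ℕ} (w : WOG n k) where
  open WOG w

  distinct : Unique (y ++ z ++ v)
  distinct = PermutationSetoid.Unique-resp-↭ (setoid ℕ) (↭⇒↭ₛ (↭-sym perm)) (unique-range1 n)

  in-range : ∀ {x} → x ∈ y ++ z ++ v → 1 ≤ x × x ≤ n
  in-range x∈ = to ∈-range1 (∈-resp-↭ perm x∈)

  y-range : ∀ {x} → x ∈ y → 1 ≤ x × x ≤ n
  y-range = in-range ∘ ∈-++⁺ˡ

  z-range : ∀ {x} → x ∈ z → 1 ≤ x × x ≤ n
  z-range = in-range ∘ ∈-++⁺ʳ y ∘ ∈-++⁺ˡ

  v-range : ∀ {x} → x ∈ v → 1 ≤ x × x ≤ n
  v-range = in-range ∘ ∈-++⁺ʳ y ∘ ∈-++⁺ʳ z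

  y≢z : ∀ {a b} → a ∈ y → b ∈ z → a ≢ b
  y≢z a∈ b∈ = unique-++-distinct distinct a∈ (∈-++⁺ˡ b∈)

  y≢v : ∀ {a b} → a ∈ y → b ∈ v → a ≢ b
  y≢v a∈ b∈ = unique-++-distinct distinct a∈ (∈-++⁺ʳ z b∈)

  z≢v : ∀ {a b} → a ∈ z → b ∈ v → a ≢ b
  z≢v a∈ b∈ = unique-++-distinct (unique-++ʳ {xs = y} distinct) a∈ b∈

  y-entry : ∀ {p} → p ≤ k ∸ r → entrySgn w p ≡ + 1 × entryVal w p ≡ nth y p
  y-entry p≤ = if-≤ᵇ-yes p≤ , if-≤ᵇ-yes p≤

  z-entry : ∀ {p} → k ∸ r < p → p ≤ k → entrySgn w p ≡ - + 1 × entryVal w p ≡ nth z (suc k ∸ p)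
  z-entry <p p≤ = trans (if-≤ᵇ-no <p) (if-≤ᵇ-yes p≤) , trans (if-≤ᵇ-no <p) (if-≤ᵇ-yes p≤)

  v-entry : ∀ j → entrySgn w (suc (k + j)) ≡ + 1 × entryVal w (suc (k + j)) ≡ nth v (suc j)
  v-entry j =
    trans (if-≤ᵇ-no k∸r<) (if-≤ᵇ-no k<) ,
    trans (if-≤ᵇ-no k∸r<) (trans (if-≤ᵇ-no k<) (cong (nth v) (suc-+-∸ k j)))
    where
    k< : k < suc (k + j)
    k< = s≤s (m≤m+n k j)
    k∸r< : k ∸ r < suc (k + j)
    k∸r< = ≤-<-trans (m∸n≤m k r) k<

  z-index : ∀ {p} → k ∸ r < p → p ≤ k → 1 ≤ suc k ∸ p × suc k ∸ p ≤ r
  z-index <p p≤ =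
    subst (1 ≤_) (sym (+-∸-assoc 1 p≤)) (s≤s z≤n) ,
    ≤-trans (∸-monoʳ-≤ (suc k) <p) (≤-reflexive (m∸[m∸n]≡n r≤k))

  y-value : ∀ {p} → 1 ≤ p → p ≤ k ∸ r → entryVal w p ∈ y
  y-value 1≤p p≤ = subst (_∈ y) (sym (proj₂ (y-entry p≤))) (nth-∈ y 1≤p (subst (_ ≤_) (sym len-y) p≤))

  z-value : ∀ {p} → k ∸ r < p → p ≤ k → entryVal w p ∈ z
  z-value <p p≤ with z-index <p p≤
  ... | 1≤j , j≤r = subst (_∈ z) (sym (proj₂ (z-entry <p p≤))) (nth-∈ z 1≤j (subst (_ ≤_) (sym len-z) j≤r))

  v-value : ∀ {c} → k < c → c ≤ n → entrySgn w c ≡ + 1 × entryVal w c ∈ v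
  v-value k<c c≤n with m≤n⇒∃[o]m+o≡n k<c
  ... | j , refl = proj₁ (v-entry j) , subst (_∈ v) (sym (proj₂ (v-entry j))) (nth-∈ v (s≤s z≤n) j<)
    where
    j< : suc j ≤ length v
    j< = subst (suc j ≤_) (sym len-v)
           (subst (_≤ n ∸ k) (suc-+-∸ k j) (∸-monoˡ-≤ k c≤n))

-- Block i of the inversion set: the roots e_p, e_p ± e_c (c > k) and e_a + e_p (a < p), where p = k+1-i

module Block {n k : ℕ} (w : WOG n k) (k<n : k < n) (i : ℕ) (1≤i : 1 ≤ i) (i≤k : i ≤ k) where
  open WOG w
  open Entries w
  open Action w

  p : ℕ
  p = suc k ∸ i

  p≡ : p ≡ suc (k ∸ i)
  p≡ = +-∸-assoc 1 i≤k

  1≤p : 1 ≤ p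
  1≤p = subst (1 ≤_) (sym p≡) (s≤s z≤n)

  p≤k : p ≤ k
  p≤k = ∸-monoʳ-≤ (suc k) 1≤i

  p≤n : p ≤ n
  p≤n = <⇒≤ (≤-<-trans p≤k k<n)

  Tail : ℕ → Set
  Tail c = k < c × c ≤ n

  k+[n∸k]≡n : k + (n ∸ k) ≡ n
  k+[n∸k]≡n = m+[n∸m]≡n (<⇒≤ k<n)

  card-Tail : HasCard Tail (n ∸ k)
  card-Tail = subst (λ m → HasCard (λ c → k < c × c ≤ m) (n ∸ k)) k+[n∸k]≡n (card-interval k (n ∸ k))

  card-Tail-with : ∀ {Q : ℕ → Set} (Q? : Decidable Q) → HasCard (λ c → Tail c × Q (entryVal w c)) (length (filter Q? v))
  card-Tail-with {Q} Q? =
    subst (λ m → HasCard (λ c → (k < c × c ≤ m) × Q (entryVal w c)) (length (filter Q? v)))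
          (trans (cong (λ m → k + m) len-v) k+[n∸k]≡n)
          (card-positions Q? (entryVal w) k v (λ j _ → proj₂ (v-entry j)))

  card-Head-with : ∀ {Q : ℕ → Set} (Q? : Decidable Q) →
                   HasCard (λ a → (0 < a × a ≤ k ∸ r) × Q (entryVal w a)) (length (filter Q? y))
  card-Head-with {Q} Q? =
    subst (λ m → HasCard (λ a → (0 < a × a ≤ m) × Q (entryVal w a)) (length (filter Q? y))) len-y
          (card-positions Q? (entryVal w) 0 y (λ j j< → proj₂ (y-entry (subst (suc j ≤_) len-y j<))))

  module Images {x : ℕ → ℤ} (image-p : wBasis w p ≗ x) where

    image-e-p : act w (vec (e p)) ≗ x
    image-e-p c = trans (image-e 1≤p p≤n c) (image-p c)

    image-p- : ∀ {c} → Tail c → act w (vec (e- (p , c))) ≗ λ c' → x c' ℤ.+ - unit (entryVal w c) c'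
    image-p- {c} (k<c , c≤n) c' =
      trans (image-e- 1≤p p≤n (≤-trans (s≤s z≤n) k<c) c≤n c')
            (cong₂ (λ s t → s ℤ.+ - t) (image-p c') (wBasis-plus w c (proj₁ (v-value k<c c≤n)) c'))

    image-p+ : ∀ {c} → Tail c → act w (vec (e+ (p , c))) ≗ λ c' → x c' ℤ.+ unit (entryVal w c) c'
    image-p+ {c} (k<c , c≤n) c' =
      trans (image-e+ 1≤p p≤n (≤-trans (s≤s z≤n) k<c) c≤n c')
            (cong₂ ℤ._+_ (image-p c') (wBasis-plus w c (proj₁ (v-value k<c c≤n)) c'))

    image-+p : ∀ {a x'} → 1 ≤ a → a < p → wBasis w a ≗ x' → act w (vec (e+ (a , p))) ≗ λ c → x' c ℤ.+ x c
    image-+p 1≤a a<p image-a c =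
      trans (image-e+ 1≤a (<⇒≤ (<-≤-trans a<p p≤n)) 1≤p p≤n c) (cong₂ ℤ._+_ (image-a c) (image-p c))

  -- Case i ≤ r: the entry at p is z̄_i, so w(e_p) = -e_P with P = z_i.
  module Negative (i≤r : i ≤ r) where

    P : ℕ
    P = nth z i

    k∸r<p : k ∸ r < p
    k∸r<p = subst (k ∸ r <_) (sym p≡) (s≤s (∸-monoʳ-≤ k i≤r))

    p-entry : entrySgn w p ≡ - + 1 × entryVal w p ≡ P
    p-entry with z-entry k∸r<p p≤k
    ... | sign , value = sign , trans value (cong (nth z) (m∸[m∸n]≡n (m≤n⇒m≤1+n i≤k)))

    P∈z : P ∈ z
    P∈z = nth-∈ z 1≤i (subst (i ≤_) (sym len-z) i≤r)

    open Images {λ c → - unit P c} (λ c → trans (wBasis-minus w p (proj₁ p-entry) c) (cong (λ t → - unit t c) (proj₂ p-entry)))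

    Inversions₁ : Root → Set
    Inversions₁ α = α ≡ e p
                  ⊎ ((Σ ℕ λ c → Tail c × α ≡ e- (p , c))
                  ⊎ (Σ ℕ λ c → (Tail c × P < entryVal w c) × α ≡ e+ (p , c)))

    invert-+ : ∀ {c} → Tail c → IsNegRoot n (act w (vec (e+ (p , c)))) ⇔ P < entryVal w c
    invert-+ {c} tail@(k<c , c≤n) =
      ⇔.trans (negRoot-≗ (λ c' → trans (image-p+ tail c') (ℤP.+-comm (- unit P c') (unit (entryVal w c) c'))))
              (difference-negRoot (proj₁ V-range) (proj₂ V-range) (proj₁ (z-range P∈z)) (proj₂ (z-range P∈z))
                                  (λ V≡P → z≢v P∈z V∈v (sym V≡P)))
      where
      V∈v = proj₂ (v-value k<c c≤n)
      V-range = v-range V∈v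

    realise₁ : ∀ {α} → Inversions₁ α → inv w α × Block1 k i α
    realise₁ (inj₁ refl) =
      (pos1 1≤p p≤n , from (negRoot-≗ image-e-p) (neg-unit-negRoot (proj₁ (z-range P∈z)) (proj₂ (z-range P∈z)))) ,
      inj₂ refl
    realise₁ (inj₂ (inj₁ (c , tail@(k<c , c≤n) , refl))) =
      (pos- 1≤p (≤-<-trans p≤k k<c) c≤n ,
       from (negRoot-≗ (image-p- tail))
            (neg-sum-negRoot (proj₁ (z-range P∈z)) (proj₂ (z-range P∈z)) (proj₁ (v-range V∈v)) (proj₂ (v-range V∈v))
                             (z≢v P∈z V∈v))) ,
      inj₁ (c , k<c , inj₁ refl)
      where
      V∈v = proj₂ (v-value k<c c≤n)
    realise₁ (inj₂ (inj₂ (c , (tail@(k<c , c≤n) , P<V) , refl))) =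
      (pos+ 1≤p (≤-<-trans p≤k k<c) c≤n , from (invert-+ tail) P<V) , inj₁ (c , k<c , inj₂ refl)

    classify₁ : ∀ {α} → inv w α → Block1 k i α → Inversions₁ α
    classify₁ _ (inj₂ refl) = inj₁ refl
    classify₁ (pos- _ _ c≤n , _) (inj₁ (c , k<c , inj₁ refl)) = inj₂ (inj₁ (c , (k<c , c≤n) , refl))
    classify₁ (pos+ _ _ c≤n , neg) (inj₁ (c , k<c , inj₂ refl)) =
      inj₂ (inj₂ (c , ((k<c , c≤n) , to (invert-+ (k<c , c≤n)) neg) , refl))

    card₁ : Card1 (inv w) k i (lam1 w i)
    card₁ =
      subst (Card1 (inv w) k i) size
        (card-resp (λ α → mk⇔ realise₁ (λ (inv-α , block) → classify₁ inv-α block))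
          (card-⊎ (λ { _ refl (inj₁ (_ , _ , ())) ; _ refl (inj₂ (_ , _ , ())) })
            (card-single (e p))
            (card-⊎ (λ { _ (_ , _ , refl) (_ , _ , ()) })
              (card-image (λ c → e- (p , c)) (λ { refl → refl }) card-Tail)
              (card-image (λ c → e+ (p , c)) (λ { refl → refl }) (card-Tail-with (P <?_))))))
      where
      size : 1 + ((n ∸ k) + countGt P v) ≡ lam1 w i
      size = trans (cong (_+ countGt P v) (sym (+-∸-assoc 1 (<⇒≤ k<n)))) (sym (if-≤ᵇ-yes i≤r))

    Inversions₂ : ℕ → Set
    Inversions₂ a = (k ∸ r < a × a ≤ (k ∸ r) + (r ∸ i)) ⊎ ((0 < a × a ≤ k ∸ r) × P < entryVal w a)

    p≡' : p ≡ suc ((k ∸ r) + (r ∸ i))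
    p≡' = trans p≡ (cong suc (trans (cong (_∸ i) (sym (m∸n+n≡m r≤k))) (+-∸-assoc (k ∸ r) i≤r)))

    invert-head : ∀ {a} → 1 ≤ a → a ≤ k ∸ r → IsNegRoot n (act w (vec (e+ (a , p)))) ⇔ P < entryVal w a
    invert-head {a} 1≤a a≤ =
      ⇔.trans (negRoot-≗ (image-+p 1≤a (≤-<-trans a≤ k∸r<p) (wBasis-plus w a (proj₁ (y-entry a≤)))))
              (difference-negRoot (proj₁ (y-range A∈y)) (proj₂ (y-range A∈y)) (proj₁ (z-range P∈z)) (proj₂ (z-range P∈z))
                                  (y≢z A∈y P∈z))
      where
      A∈y = y-value 1≤a a≤

    invert-middle : ∀ {a} → k ∸ r < a → a < p → IsNegRoot n (act w (vec (e+ (a , p))))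
    invert-middle {a} <a a<p =
      from (negRoot-≗ (image-+p (≤-trans (s≤s z≤n) <a) a<p (wBasis-minus w a (proj₁ (z-entry <a a≤k)))))
           (neg-sum-negRoot (proj₁ (z-range A∈z)) (proj₂ (z-range A∈z)) (proj₁ (z-range P∈z)) (proj₂ (z-range P∈z)) A≢P)
      where
      a≤k = <⇒≤ (<-≤-trans a<p p≤k)
      A∈z = z-value <a a≤k
      -- the entry at a is z_j with j = k+1-a > i, hence larger than P = z_i
      A≢P : entryVal w a ≢ P
      A≢P A≡P = <-irrefl (trans (sym A≡P) (proj₂ (z-entry <a a≤k)))
        (nth-increasing (Linked⇒AllPairs <-trans z-inc) 1≤i
          (subst (_< suc k ∸ a) (m∸[m∸n]≡n (m≤n⇒m≤1+n i≤k)) (∸-monoʳ-< a<p (m≤n⇒m≤1+n p≤k)))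
          (subst (_ ≤_) (sym len-z) (proj₂ (z-index <a a≤k))))

    realise₂ : ∀ {a} → Inversions₂ a → a < p × inv w (e+ (a , p))
    realise₂ {a} (inj₁ (<a , a≤)) =
      a<p , pos+ (≤-trans (s≤s z≤n) <a) a<p p≤n , invert-middle <a a<p
      where
      a<p : a < p
      a<p = subst (a <_) (sym p≡') (s≤s a≤)
    realise₂ (inj₂ ((1≤a , a≤) , P<A)) =
      a<p , pos+ 1≤a a<p p≤n , from (invert-head 1≤a a≤) P<A
      where
      a<p = ≤-<-trans a≤ k∸r<p

    classify₂ : ∀ {a} → a < p → inv w (e+ (a , p)) → Inversions₂ a
    classify₂ {a} a<p (pos+ 1≤a _ _ , neg) with a ≤? k ∸ r
    ... | yes a≤ = inj₂ ((1≤a , a≤) , to (invert-head 1≤a a≤) neg)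
    ... | no a≰ = inj₁ (≰⇒> a≰ , ≤-pred (subst (a <_) p≡' a<p))

    card₂ : Card2 (inv w) k i (lam2 w i)
    card₂ =
      subst (Card2 (inv w) k i) size
        (card-resp (λ a → mk⇔ realise₂ (λ (a<p , inv-a) → classify₂ a<p inv-a))
          (card-⊎ (λ { _ (<a , _) ((_ , a≤) , _) → <⇒≱ <a a≤ })
            (card-interval (k ∸ r) (r ∸ i))
            (card-Head-with (P <?_))))
      where
      -- the entries of z above z_i are z_{i+1}, …, z_r
      above-in-z : countGt P z ≡ r ∸ i
      above-in-z = trans (countGt-increasing (Linked⇒AllPairs <-trans z-inc) 1≤i (subst (i ≤_) (sym len-z) i≤r))
                         (cong (_∸ i) len-z)

      size : (r ∸ i) + countGt P y ≡ lam2 w i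
      size = trans (cong (_+ countGt P y) (sym above-in-z)) (sym (if-≤ᵇ-yes i≤r))

  -- Case r < i: the entry at p is y_p, so w(e_p) = +e_P with P = y_p.
  module Positive (r<i : r < i) where

    P : ℕ
    P = nth y p

    p≤k∸r : p ≤ k ∸ r
    p≤k∸r = ∸-monoʳ-≤ (suc k) r<i

    P∈y : P ∈ y
    P∈y = subst (_∈ y) (proj₂ (y-entry p≤k∸r)) (y-value 1≤p p≤k∸r)

    open Images {unit P} (λ c → trans (wBasis-plus w p (proj₁ (y-entry p≤k∸r)) c) (cong (λ t → unit t c) (proj₂ (y-entry p≤k∸r))))

    Inversions₁ : Root → Set
    Inversions₁ α = Σ ℕ λ c → (Tail c × entryVal w c < P) × α ≡ e- (p , c)

    invert-- : ∀ {c} → Tail c → IsNegRoot n (act w (vec (e- (p , c)))) ⇔ entryVal w c < P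
    invert-- {c} tail@(k<c , c≤n) =
      ⇔.trans (negRoot-≗ (image-p- tail))
              (difference-negRoot (proj₁ (y-range P∈y)) (proj₂ (y-range P∈y)) (proj₁ (v-range V∈v)) (proj₂ (v-range V∈v))
                                  (y≢v P∈y V∈v))
      where
      V∈v = proj₂ (v-value k<c c≤n)

    realise₁ : ∀ {α} → Inversions₁ α → inv w α × Block1 k i α
    realise₁ (c , (tail@(k<c , c≤n) , V<P) , refl) =
      (pos- 1≤p (≤-<-trans p≤k k<c) c≤n , from (invert-- tail) V<P) , inj₁ (c , k<c , inj₁ refl)

    classify₁ : ∀ {α} → inv w α → Block1 k i α → Inversions₁ α
    classify₁ (_ , neg) (inj₂ refl) = ⊥-elim (unit-not-negRoot P (to (negRoot-≗ image-e-p) neg))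
    classify₁ (pos- _ _ c≤n , neg) (inj₁ (c , k<c , inj₁ refl)) = c , ((k<c , c≤n) , to (invert-- (k<c , c≤n)) neg) , refl
    classify₁ (pos+ _ _ c≤n , neg) (inj₁ (c , k<c , inj₂ refl)) =
      ⊥-elim (sum-not-negRoot P (entryVal w c) (to (negRoot-≗ (image-p+ (k<c , c≤n))) neg))

    card₁ : Card1 (inv w) k i (lam1 w i)
    card₁ =
      subst (Card1 (inv w) k i) (sym (if-≤ᵇ-no r<i))
        (card-resp (λ α → mk⇔ realise₁ (λ (inv-α , block) → classify₁ inv-α block))
          (card-image (λ c → e- (p , c)) (λ { refl → refl }) (card-Tail-with (_<? P))))

    -- second block: every a < p is a y-position, and e_{y_a} + e_P is never a negative root
    card₂ : Card2 (inv w) k i (lam2 w i)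
    card₂ = subst (Card2 (inv w) k i) (sym (if-≤ᵇ-no r<i)) (card-empty no-inversion)
      where
      no-inversion : ∀ a → ¬ (a < p × inv w (e+ (a , p)))
      no-inversion a (a<p , pos+ 1≤a _ _ , neg) =
        sum-not-negRoot (entryVal w a) P
          (to (negRoot-≗ (image-+p 1≤a a<p (wBasis-plus w a (proj₁ (y-entry (<⇒≤ (<-≤-trans a<p p≤k∸r))))))) neg)

lemma3p6 : (n k : ℕ) → 1 ≤ k → k < n → (w : WOG n k) → (i : ℕ) → 1 ≤ i → i ≤ k →
    Card1 (inv w) k i (lam1 w i) × Card2 (inv w) k i (lam2 w i)
lemma3p6 n k _ k<n w i 1≤i i≤k with i ≤? WOG.r w
... | yes i≤r = Negative.card₁ i≤r , Negative.card₂ i≤r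
  where open Block w k<n i 1≤i i≤k
... | no i≰r = Positive.card₁ (≰⇒> i≰r) , Positive.card₂ (≰⇒> i≰r)
  where open Block w k<n i 1≤i i≤k
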